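{- Let $q$ be a power of an odd prime, $c\in\mathbb{F}_q^*$, and $f:\mathbb{F}_{q^2}\to\mathbb{F}_{q^2}$, $f(X)=c(X^{q+1}+X^2)$. Let $\beta\in\mathbb{F}_{q^2}$ with $\beta^2=b$, where $b$ is a non-square in $\mathbb{F}_q$ (so $\{1,\beta\}$ is an $\mathbb{F}_q$-basis of $\mathbb{F}_{q^2}$). If $\alpha\in\beta\mathbb{F}_q$, then $\#f^{ -1}(\alpha)=q$ if $\alpha=0$ and $\#f^{ -1}(\alpha)=0$ if $\alpha\neq0$.
   Context: $f^{ -1}(\alpha)=\{\gamma\in\mathbb{F}_{q^2}: f(\gamma)=\alpha\}$; $\beta\mathbb{F}_q=\{\beta t: t\in\mathbb{F}_q\}$. -}

module Defs where

open import Data.Nat using (ℕ; zero; suc)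
open import Data.Fin using (Fin)
open import Data.List using (length; filter; allFin)
open import Data.Product using (∃)
open import Function.Bundles using (_↔_; Inverse)
open import Relation.Binary.PropositionalEquality using (_≡_; _≢_)
open import Relation.Binary.Definitions using (DecidableEquality)
open import Algebra.Structures using (IsCommutativeRing)

record FiniteField : Set₁ where
  infixl 6 _+_
  infixl 7 _*_
  field
    Carrier    : Set
    _+_ _*_    : Carrier → Carrier → Carrier
    -_         : Carrier → Carrier
    0# 1#      : Carrier
    isCommRing : IsCommutativeRing _≡_ _+_ _*_ -_ 0# 1#
    0≢1        : 0# ≢ 1#
    inverse    : ∀ x → x ≢ 0# → ∃ λ y → x * y ≡ 1#
    _≟_        : DecidableEquality Carrier
    size       : ℕ
    enum       : Fin size ↔ Carrier

module FF (L : FiniteField) where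
  open FiniteField L public

  infixr 8 _↑_
  _↑_ : Carrier → ℕ → Carrier
  x ↑ zero  = 1#
  x ↑ suc n = x * (x ↑ n)

  preimageCount : (Carrier → Carrier) → Carrier → ℕ
  preimageCount g α =
    length (filter (λ i → g (Inverse.to enum i) ≟ α) (allFin size))

module Submission where

-- Let σ x = x ^ q. As the field has q² elements, Fermat's little theorem makes σ an involution,
-- and in characteristic p it is a ring homomorphism; σ β = - β because β² = b is not a square
-- among the σ-fixed elements. Write f x = c x Tr x with Tr x = x + σ x. Since σ c = c,
-- f x + σ (f x) = c (Tr x)², so a value α of f with σ α = - α forces Tr x = 0 and hence α = 0.
-- The zeros of f form the kernel K of Tr. As 2 is invertible, every element is uniquely a sum of
-- a σ-fixed and a σ-antifixed one, and multiplication by β maps the former onto the latter, so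
-- F_{q²} ≅ K × K and |K| = q.

open import Defs
open import Data.Nat using (ℕ; _^_; _≥_)
open import Data.Nat.Primality using (Prime)
open import Data.Product using (∃; _×_)
open import Relation.Nullary using (¬_)
open import Relation.Binary.PropositionalEquality using (_≡_; _≢_)

open import Level using (0ℓ)
open import Algebra.Bundles using (CommutativeRing; CommutativeMonoid)
import Algebra.Properties.CommutativeMonoid.Sum
import Algebra.Properties.CommutativeSemiring.Binomial
import Algebra.Properties.CommutativeSemiring.Exp
open import Axiom.UniquenessOfIdentityProofs using (module Decidable⇒UIP)
open import Data.Empty using (⊥-elim)
open import Data.Fin using (Fin; zero; suc; punchIn; toℕ; fromℕ; inject₁)
open import Data.Fin.Permutation using (↔⇒≡)
open import Data.Fin.Properties using (*↔×; punchInᵢ≢i; toℕ-fromℕ; toℕ-inject₁; toℕ<n)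
open import Data.Integer as ℤ using (ℤ; -[1+_]; _⊖_; _◃_; sign; ∣_∣)
import Data.Integer.Properties as ℤ
open import Data.List using (length; filter; tabulate)
open import Data.Maybe using (Maybe; just; nothing)
open import Data.Nat as ℕ using (zero; suc; _<_; _≤_; _∸_; _!)
import Data.Nat.Properties as ℕ
open import Data.Nat.Combinatorics using (_C_; nCn≡1; nCk≡n!/k![n-k]!; k![n∸k]!∣n!)
open import Data.Nat.DivMod using (m/n*n≡m)
open import Data.Nat.Divisibility using (_∣_; divides; _∣0; ∣-refl; ∣m∣n⇒∣m+n; ∣1⇒≡1; >⇒∤; m∣m*n)
open import Data.Nat.Primality using (euclidsLemma; prime⇒nonZero; prime⇒irreducible)
open import Data.Product using (Σ; _,_; proj₁; proj₂; map₂)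
open import Data.Product.Function.Dependent.Propositional using (Σ-↔)
open import Data.Product.Function.NonDependent.Propositional using (_×-↔_)
open import Data.Sign as Sign using (Sign)
open import Data.Sum using (_⊎_; inj₁; inj₂; [_,_])
open import Data.Vec.Functional using (removeAt; init)
open import Function using (_∘_; id)
open import Function.Bundles using (_↔_; mk↔ₛ′; Inverse; _⇔_; mk⇔; Equivalence)
open import Function.Construct.Composition using (_↔-∘_)
open import Function.Construct.Identity using (↔-id)
open import Function.Construct.Symmetry using (↔-sym)
open import Relation.Nullary using (yes; no; Irrelevant; contradiction)
open import Relation.Unary using (Decidable)
open import Relation.Binary.Definitions using (tri<; tri≈; tri>)
open import Relation.Binary.PropositionalEquality
  using (refl; cong; cong₂; subst; module ≡-Reasoning)
  renaming (sym to ≡-sym; trans to ≡-trans)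

-- Binomial coefficients and counting

prime∤! : ∀ {p n} → Prime p → n < p → ¬ p ∣ n !
prime∤! {n = zero}  p-prime _   p∣1 with ∣1⇒≡1 p∣1
... | refl = contradiction p-prime λ ()
prime∤! {n = suc n} p-prime n<p p∣n! with euclidsLemma (suc n) (n !) p-prime p∣n!
... | inj₁ p∣1+n = >⇒∤ n<p p∣1+n
... | inj₂ p∣n!′ = prime∤! p-prime (ℕ.<-trans (ℕ.n<1+n n) n<p) p∣n!′

C*factorials≡! : ∀ {n k} → k ≤ n → (n C k) ℕ.* (k ! ℕ.* (n ∸ k) !) ≡ n !
C*factorials≡! {n} {k} k≤n =
  ≡-trans (cong (ℕ._* (k ! ℕ.* (n ∸ k) !)) (nCk≡n!/k![n-k]! k≤n)) (m/n*n≡m (k![n∸k]!∣n! k≤n))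
  where instance _ = k ℕ.!* (n ∸ k) !≢0

n∣n! : ∀ n .{{_ : ℕ.NonZero n}} → n ∣ n !
n∣n! (suc n) = m∣m*n (n !)

prime∣choose : ∀ {p k} → Prime p → 0 < k → k < p → p ∣ p C k
prime∣choose {p} {k} p-prime 0<k k<p
  with euclidsLemma (p C k) (k ! ℕ.* (p ∸ k) !) p-prime
         (subst (p ∣_) (≡-sym (C*factorials≡! (ℕ.<⇒≤ k<p))) (n∣n! p {{prime⇒nonZero p-prime}}))
... | inj₁ p∣pCk = p∣pCk
... | inj₂ p∣k![p∸k]! with euclidsLemma (k !) ((p ∸ k) !) p-prime p∣k![p∸k]!
...   | inj₁ p∣k!     = contradiction p∣k! (prime∤! p-prime k<p)
...   | inj₂ p∣[p∸k]! = contradiction p∣[p∸k]! (prime∤! p-prime (ℕ.∸-monoʳ-< 0<k (ℕ.<⇒≤ k<p)))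

m*m≡n*n⇒m≡n : ∀ {m n} → m ℕ.* m ≡ n ℕ.* n → m ≡ n
m*m≡n*n⇒m≡n {m} {n} eq with ℕ.<-cmp m n
... | tri< m<n _ _ = contradiction eq (ℕ.<⇒≢ (ℕ.*-mono-< m<n m<n))
... | tri≈ _ m≡n _ = m≡n
... | tri> _ _ n<m = contradiction (≡-sym eq) (ℕ.<⇒≢ (ℕ.*-mono-< n<m n<m))

Fin↔⊥⇒≡0 : ∀ {m} {A : Set} → Fin m ↔ A → ¬ A → m ≡ 0
Fin↔⊥⇒≡0 {zero}  _   _  = refl
Fin↔⊥⇒≡0 {suc m} m↔A ¬A = contradiction (Inverse.to m↔A zero) ¬A

module _ {A : Set} {P : A → Set} (P? : Decidable P) (P-irrelevant : ∀ {x} → Irrelevant (P x)) where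

  length-filter-tabulate↔ : ∀ {n} (h : Fin n → A) →
                            Fin (length (filter P? (tabulate h))) ↔ Σ (Fin n) (P ∘ h)
  length-filter-tabulate↔ {zero}  h = mk↔ₛ′ (λ ()) (λ ()) (λ ()) (λ ())
  length-filter-tabulate↔ {suc n} h with P? (h zero) | length-filter-tabulate↔ (h ∘ suc)
  ... | yes p₀ | rest = mk↔ₛ′ to from to∘from from∘to
    where
    open Inverse rest renaming (to to to′; from to from′)
    to : Fin (suc _) → Σ (Fin (suc n)) (P ∘ h)
    to zero    = zero , p₀
    to (suc j) = suc (proj₁ (to′ j)) , proj₂ (to′ j)
    from : Σ (Fin (suc n)) (P ∘ h) → Fin (suc _)
    from (zero  , _)  = zero
    from (suc i , pᵢ) = suc (from′ (i , pᵢ))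
    to∘from : ∀ y → to (from y) ≡ y
    to∘from (zero  , p)  = cong (zero ,_) (P-irrelevant p₀ p)
    to∘from (suc i , pᵢ) = cong (λ (j , pⱼ) → suc j , pⱼ) (strictlyInverseˡ (i , pᵢ))
    from∘to : ∀ j → from (to j) ≡ j
    from∘to zero    = refl
    from∘to (suc j) = cong suc (strictlyInverseʳ j)
  ... | no ¬p₀ | rest = mk↔ₛ′ to from to∘from from∘to
    where
    open Inverse rest renaming (to to to′; from to from′)
    to : Fin _ → Σ (Fin (suc n)) (P ∘ h)
    to j = suc (proj₁ (to′ j)) , proj₂ (to′ j)
    from : Σ (Fin (suc n)) (P ∘ h) → Fin _
    from (zero  , p₀) = contradiction p₀ ¬p₀
    from (suc i , pᵢ) = from′ (i , pᵢ)
    to∘from : ∀ y → to (from y) ≡ y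
    to∘from (zero  , p₀) = contradiction p₀ ¬p₀
    to∘from (suc i , pᵢ) = cong (λ (j , pⱼ) → suc j , pⱼ) (strictlyInverseˡ (i , pᵢ))
    from∘to : ∀ j → from (to j) ≡ j
    from∘to = strictlyInverseʳ

-- Ring solver with integer coefficients

-- Algebra.Solver.Ring.Simple would use R itself as coefficients, but its equality test does
-- not compute for an abstract ring; the image of ℤ in R is enough for ring identities.
module IntegerCoefficientSolver {c ℓ} (R : CommutativeRing c ℓ) where

  open CommutativeRing R renaming (refl to ≈-refl)
  open import Algebra.Properties.Ring ring
    using (-0#≈0#; -‿involutive; -1*x≈-x)
  open import Algebra.Properties.AbelianGroup +-abelianGroup using (⁻¹-∙-comm)
  open import Algebra.Properties.CommutativeSemigroup +-commutativeSemigroup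
    using () renaming (interchange to +-interchange)
  open import Algebra.Properties.CommutativeSemigroup *-commutativeSemigroup
    using () renaming (interchange to *-interchange)
  open import Algebra.Properties.Semiring.Mult semiring
    using (×-homo-+; ×1-homo-*) renaming (_×_ to _·_)
  import Algebra.Solver.Ring.AlmostCommutativeRing as ACR
  open import Relation.Binary.Reasoning.Setoid setoid

  infix 8 _×1
  _×1 : ℕ → Carrier
  n ×1 = n · 1#

  fromSign : Sign → Carrier
  fromSign Sign.+ = 1#
  fromSign Sign.- = - 1#

  fromℤ : ℤ → Carrier
  fromℤ (ℤ.+ n)    = n ×1
  fromℤ -[1+ n ] = - (suc n ×1)

  fromℤ-⊖ : ∀ m n → fromℤ (m ⊖ n) ≈ m ×1 + - (n ×1)
  fromℤ-⊖ m       zero    = sym (trans (+-congˡ -0#≈0#) (+-identityʳ _))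
  fromℤ-⊖ zero    (suc n) = sym (+-identityˡ _)
  fromℤ-⊖ (suc m) (suc n) = begin
    fromℤ (suc m ⊖ suc n)                  ≈⟨ reflexive (cong fromℤ (ℤ.[1+m]⊖[1+n]≡m⊖n m n)) ⟩
    fromℤ (m ⊖ n)                          ≈⟨ fromℤ-⊖ m n ⟩
    m ×1 + - (n ×1)                        ≈⟨ +-identityˡ _ ⟨
    0# + (m ×1 + - (n ×1))                 ≈⟨ +-congʳ (-‿inverseʳ 1#) ⟨
    (1# + - 1#) + (m ×1 + - (n ×1))        ≈⟨ +-interchange _ _ _ _ ⟩
    (1# + m ×1) + (- 1# + - (n ×1))        ≈⟨ +-congˡ (⁻¹-∙-comm 1# (n ×1)) ⟩
    suc m ×1 + - (suc n ×1)                ∎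

  fromℤ-+ : ∀ i j → fromℤ (i ℤ.+ j) ≈ fromℤ i + fromℤ j
  fromℤ-+ (ℤ.+ m)    (ℤ.+ n)    = ×-homo-+ 1# m n
  fromℤ-+ (ℤ.+ m)    -[1+ n ] = fromℤ-⊖ m (suc n)
  fromℤ-+ -[1+ m ] (ℤ.+ n)    = trans (fromℤ-⊖ n (suc m)) (+-comm _ _)
  fromℤ-+ -[1+ m ] -[1+ n ] = begin
    - (suc (suc m ℕ.+ n) ×1)               ≈⟨ reflexive (cong (λ k → - (k ×1)) (ℕ.+-suc (suc m) n)) ⟨
    - ((suc m ℕ.+ suc n) ×1)               ≈⟨ -‿cong (×-homo-+ 1# (suc m) (suc n)) ⟩
    - (suc m ×1 + suc n ×1)                ≈⟨ ⁻¹-∙-comm _ _ ⟨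
    - (suc m ×1) + - (suc n ×1)            ∎

  fromℤ-- : ∀ i → fromℤ (ℤ.- i) ≈ - fromℤ i
  fromℤ-- (ℤ.+ zero)  = sym -0#≈0#
  fromℤ-- (ℤ.+ suc n) = ≈-refl
  fromℤ-- -[1+ n ]  = sym (-‿involutive _)

  fromℤ-◃ : ∀ s n → fromℤ (s ◃ n) ≈ fromSign s * n ×1
  fromℤ-◃ s        zero    = sym (zeroʳ _)
  fromℤ-◃ Sign.+ (suc n) = sym (*-identityˡ _)
  fromℤ-◃ Sign.- (suc n) = sym (-1*x≈-x _)

  fromSign-* : ∀ s t → fromSign (s Sign.* t) ≈ fromSign s * fromSign t
  fromSign-* Sign.+ t      = sym (*-identityˡ _)
  fromSign-* Sign.- Sign.+ = sym (*-identityʳ _)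
  fromSign-* Sign.- Sign.- = sym (trans (-1*x≈-x _) (-‿involutive 1#))

  fromℤ-* : ∀ i j → fromℤ (i ℤ.* j) ≈ fromℤ i * fromℤ j
  fromℤ-* i j = begin
    fromℤ (sign i Sign.* sign j ◃ ∣ i ∣ ℕ.* ∣ j ∣)
      ≈⟨ fromℤ-◃ (sign i Sign.* sign j) (∣ i ∣ ℕ.* ∣ j ∣) ⟩
    fromSign (sign i Sign.* sign j) * (∣ i ∣ ℕ.* ∣ j ∣) ×1
      ≈⟨ *-cong (fromSign-* (sign i) (sign j)) (×1-homo-* ∣ i ∣ ∣ j ∣) ⟩
    (fromSign (sign i) * fromSign (sign j)) * (∣ i ∣ ×1 * ∣ j ∣ ×1)
      ≈⟨ *-interchange _ _ _ _ ⟩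
    (fromSign (sign i) * ∣ i ∣ ×1) * (fromSign (sign j) * ∣ j ∣ ×1)
      ≈⟨ *-cong (fromℤ-sign-abs i) (fromℤ-sign-abs j) ⟩
    fromℤ i * fromℤ j
      ∎
    where
    fromℤ-sign-abs : ∀ k → fromSign (sign k) * ∣ k ∣ ×1 ≈ fromℤ k
    fromℤ-sign-abs k = trans (sym (fromℤ-◃ (sign k) ∣ k ∣)) (reflexive (cong fromℤ (ℤ.◃-inverse k)))

  fromℤ-homomorphism : ACR._-Raw-AlmostCommutative⟶_ ℤ.+-*-rawRing (ACR.fromCommutativeRing R)
  fromℤ-homomorphism = record
    { ⟦_⟧ = fromℤ ; +-homo = fromℤ-+ ; *-homo = fromℤ-* ; -‿homo = fromℤ--
    ; 0-homo = ≈-refl ; 1-homo = +-identityʳ 1# }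

  fromℤ-≟ : ∀ i j → Maybe (fromℤ i ≈ fromℤ j)
  fromℤ-≟ i j with i ℤ.≟ j
  ... | yes i≡j = just (reflexive (cong fromℤ i≡j))
  ... | no _    = nothing

  open import Algebra.Solver.Ring ℤ.+-*-rawRing (ACR.fromCommutativeRing R) fromℤ-homomorphism fromℤ-≟
    public


-- Finite fields

module FiniteFieldTheory (L : FiniteField) where

  open FF L

  commutativeRing : CommutativeRing 0ℓ 0ℓ
  commutativeRing = record { isCommutativeRing = isCommRing }

  module R = CommutativeRing commutativeRing
  open import Algebra.Properties.Ring R.ring
    using (-‿involutive; -‿distribˡ-*; -0#≈0#; x+x≈x⇒x≈0; +-identityˡ-unique)
  open import Algebra.Properties.Group R.+-group using (inverseˡ-unique; inverseʳ-unique)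
  open import Algebra.Properties.Semiring.Mult R.semiring
    using (×-assocˡ; ×-assoc-*; ×1-homo-*) renaming (_×_ to _·_)
  module Exp = Algebra.Properties.CommutativeSemiring.Exp R.commutativeSemiring
  module Binomial = Algebra.Properties.CommutativeSemiring.Binomial R.commutativeSemiring
  module ∑ = Algebra.Properties.CommutativeMonoid.Sum R.+-commutativeMonoid
  module ∏ = Algebra.Properties.CommutativeMonoid.Sum R.*-commutativeMonoid
  open IntegerCoefficientSolver commutativeRing using (solve; _:=_; _:+_; _:*_; :-_)
  open ≡-Reasoning

  elem : Fin size → Carrier
  elem = Inverse.to enum

  ↑≡^ : ∀ x n → x ↑ n ≡ x Exp.^ n
  ↑≡^ x zero    = refl
  ↑≡^ x (suc n) = cong (x *_) (↑≡^ x n)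

  ↑-assoc : ∀ x m n → (x ↑ m) ↑ n ≡ x ↑ (m ℕ.* n)
  ↑-assoc x m n = begin
    (x ↑ m) ↑ n          ≡⟨ ≡-trans (↑≡^ (x ↑ m) n) (cong (Exp._^ n) (↑≡^ x m)) ⟩
    (x Exp.^ m) Exp.^ n  ≡⟨ Exp.^-assocʳ x m n ⟩
    x Exp.^ (m ℕ.* n)    ≡⟨ ↑≡^ x (m ℕ.* n) ⟨
    x ↑ (m ℕ.* n)        ∎

  ↑-distrib-* : ∀ x y n → (x * y) ↑ n ≡ x ↑ n * y ↑ n
  ↑-distrib-* x y n = begin
    (x * y) ↑ n              ≡⟨ ↑≡^ (x * y) n ⟩
    (x * y) Exp.^ n          ≡⟨ Exp.^-distrib-* x y n ⟩
    x Exp.^ n * y Exp.^ n    ≡⟨ cong₂ _*_ (↑≡^ x n) (↑≡^ y n) ⟨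
    x ↑ n * y ↑ n            ∎

  ≡-irrelevant : {x y : Carrier} → Irrelevant (x ≡ y)
  ≡-irrelevant = Decidable⇒UIP.≡-irrelevant _≟_

  subtype-≡ : ∀ {f g : Carrier → Carrier} {u v : Σ Carrier λ x → f x ≡ g x} →
              proj₁ u ≡ proj₁ v → u ≡ v
  subtype-≡ {u = x , _} {v = .x , _} refl = cong (x ,_) (≡-irrelevant _ _)

  subtype-↔ : ∀ {f g f′ g′ : Carrier → Carrier} →
              (∀ {x} → f x ≡ g x → f′ x ≡ g′ x) → (∀ {x} → f′ x ≡ g′ x → f x ≡ g x) →
              (Σ Carrier λ x → f x ≡ g x) ↔ (Σ Carrier λ x → f′ x ≡ g′ x)
  subtype-↔ ⇒ ⇐ = mk↔ₛ′ (map₂ ⇒) (map₂ ⇐) (λ _ → subtype-≡ refl) (λ _ → subtype-≡ refl)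

  preimageCount↔ : ∀ g α → Fin (preimageCount g α) ↔ Σ Carrier λ x → g x ≡ α
  preimageCount↔ g α =
    Σ-↔ enum (↔-id _) ↔-∘ length-filter-tabulate↔ (λ i → g (elem i) ≟ α) ≡-irrelevant id

  1≢0 : 1# ≢ 0#
  1≢0 = 0≢1 ∘ ≡-sym

  x*y≡1⇒x*[y*z]≡z : ∀ {x y} → x * y ≡ 1# → ∀ z → x * (y * z) ≡ z
  x*y≡1⇒x*[y*z]≡z {x} {y} xy≡1 z = begin
    x * (y * z)  ≡⟨ R.*-assoc x y z ⟨
    (x * y) * z  ≡⟨ cong (_* z) xy≡1 ⟩
    1# * z       ≡⟨ R.*-identityˡ z ⟩
    z            ∎

  x*y≡1⇒y*x≡1 : ∀ {x y} → x * y ≡ 1# → y * x ≡ 1#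
  x*y≡1⇒y*x≡1 {x} {y} = ≡-trans (R.*-comm y x)

  *-cancelˡ : ∀ {x y z} → x ≢ 0# → x * y ≡ x * z → y ≡ z
  *-cancelˡ {x} {y} {z} x≢0 xy≡xz with inverse x x≢0
  ... | x⁻¹ , xx⁻¹≡1 = begin
    y              ≡⟨ x*y≡1⇒x*[y*z]≡z (x*y≡1⇒y*x≡1 xx⁻¹≡1) y ⟨
    x⁻¹ * (x * y)  ≡⟨ cong (x⁻¹ *_) xy≡xz ⟩
    x⁻¹ * (x * z)  ≡⟨ x*y≡1⇒x*[y*z]≡z (x*y≡1⇒y*x≡1 xx⁻¹≡1) z ⟩
    z              ∎

  x*y≡0⇒x≡0⊎y≡0 : ∀ {x y} → x * y ≡ 0# → x ≡ 0# ⊎ y ≡ 0#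
  x*y≡0⇒x≡0⊎y≡0 {x} {y} xy≡0 with x ≟ 0#
  ... | yes x≡0 = inj₁ x≡0
  ... | no  x≢0 = inj₂ (*-cancelˡ x≢0 (≡-trans xy≡0 (≡-sym (R.zeroʳ x))))

  x^n≡0⇒x≡0 : ∀ {x} n → x ↑ n ≡ 0# → x ≡ 0#
  x^n≡0⇒x≡0 zero    1≡0  = contradiction 1≡0 1≢0
  x^n≡0⇒x≡0 (suc n) xxⁿ≡0 with x*y≡0⇒x≡0⊎y≡0 xxⁿ≡0
  ... | inj₁ x≡0  = x≡0
  ... | inj₂ xⁿ≡0 = x^n≡0⇒x≡0 n xⁿ≡0

  x*x≡y*y⇒x≡y⊎x≡-y : ∀ {x y} → x * x ≡ y * y → x ≡ y ⊎ x ≡ - y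
  x*x≡y*y⇒x≡y⊎x≡-y {x} {y} xx≡yy with x*y≡0⇒x≡0⊎y≡0 [x-y][x+y]≡0
    where
    [x-y][x+y]≡0 : (x + - y) * (x + y) ≡ 0#
    [x-y][x+y]≡0 = begin
      (x + - y) * (x + y)  ≡⟨ solve 2 (λ x y → (x :+ :- y) :* (x :+ y) := x :* x :+ :- (y :* y)) refl x y ⟩
      x * x + - (y * y)    ≡⟨ cong (_+ - (y * y)) xx≡yy ⟩
      y * y + - (y * y)    ≡⟨ R.-‿inverseʳ (y * y) ⟩
      0#                   ∎
  ... | inj₁ x-y≡0 = inj₁ (≡-trans (inverseˡ-unique x (- y) x-y≡0) (-‿involutive y))
  ... | inj₂ x+y≡0 = inj₂ (inverseˡ-unique x y x+y≡0)

  module _ {c ℓ} (M : CommutativeMonoid c ℓ) where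
    open CommutativeMonoid M using (_≈_; trans; reflexive)
    open Algebra.Properties.CommutativeMonoid.Sum M using (sum; sum-permute; sum-cong-≗)

    sum-reindex : (φ : Carrier ↔ Carrier) (g : Carrier → CommutativeMonoid.Carrier M) →
                  sum (g ∘ Inverse.to φ ∘ elem) ≈ sum (g ∘ elem)
    sum-reindex φ g = CommutativeMonoid.sym M (trans (sum-permute (g ∘ elem) π)
      (reflexive (sum-cong-≗ λ i → cong g (Inverse.strictlyInverseˡ enum (Inverse.to φ (elem i))))))
      where
      π = ↔-sym enum ↔-∘ (φ ↔-∘ enum)

  translation↔ : Carrier → Carrier ↔ Carrier
  translation↔ a = mk↔ₛ′ (a +_) (- a +_)
    (λ y → solve 2 (λ a y → a :+ (:- a :+ y) := y) refl a y)
    (λ y → solve 2 (λ a y → :- a :+ (a :+ y) := y) refl a y)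

  scaling↔ : ∀ {a} → a ≢ 0# → Carrier ↔ Carrier
  scaling↔ {a} a≢0 with inverse a a≢0
  ... | a⁻¹ , aa⁻¹≡1 = mk↔ₛ′ (a *_) (a⁻¹ *_)
    (x*y≡1⇒x*[y*z]≡z aa⁻¹≡1) (x*y≡1⇒x*[y*z]≡z (x*y≡1⇒y*x≡1 aa⁻¹≡1))

  size·1≡0 : size · 1# ≡ 0#
  size·1≡0 = +-identityˡ-unique (size · 1#) (∑.sum elem) (begin
    size · 1# + ∑.sum elem               ≡⟨ cong (_+ ∑.sum elem) (∑.sum-replicate size) ⟨
    ∑.sum {size} (λ _ → 1#) + ∑.sum elem ≡⟨ ∑.∑-distrib-+ (λ _ → 1#) elem ⟨
    ∑.sum (λ i → 1# + elem i)            ≡⟨ sum-reindex R.+-commutativeMonoid (translation↔ 1#) id ⟩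
    ∑.sum elem                           ∎)

  ∏-≢0 : ∀ {n} (t : Fin n → Carrier) → (∀ i → t i ≢ 0#) → ∏.sum t ≢ 0#
  ∏-≢0 {zero}  t _   = 1≢0
  ∏-≢0 {suc n} t t≢0 ∏t≡0 with x*y≡0⇒x≡0⊎y≡0 ∏t≡0
  ... | inj₁ t₀≡0    = t≢0 zero t₀≡0
  ... | inj₂ ∏rest≡0 = ∏-≢0 (t ∘ suc) (t≢0 ∘ suc) ∏rest≡0

  ∏-single : ∀ {n} (t : Fin n → Carrier) i → (∀ j → j ≢ i → t j ≡ 1#) → ∏.sum t ≡ t i
  ∏-single {suc n} t i t≡1 = begin
    ∏.sum t                     ≡⟨ ∏.sum-remove t ⟩
    t i * ∏.sum (removeAt t i)  ≡⟨ cong (t i *_) ∏-removeAt≡1 ⟩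
    t i * 1#                    ≡⟨ R.*-identityʳ (t i) ⟩
    t i                         ∎
    where
    ∏-removeAt≡1 : ∏.sum (removeAt t i) ≡ 1#
    ∏-removeAt≡1 =
      ≡-trans (∏.sum-cong-≗ λ j → t≡1 (punchIn i j) (punchInᵢ≢i i j)) (∏.sum-replicate-zero n)

  -- Fermat's little theorem by comparing ∏_y u(x y) with ∏_y u(y), where u replaces 0 by 1;
  -- the factor x lost at y = 0 is put back by `correction`.
  unzero : Carrier → Carrier
  unzero y with y ≟ 0#
  ... | yes _ = 1#
  ... | no  _ = y

  unzero≢0 : ∀ y → unzero y ≢ 0#
  unzero≢0 y with y ≟ 0#
  ... | yes _   = 1≢0
  ... | no  y≢0 = y≢0

  correction : Carrier → Carrier → Carrier
  correction x y with y ≟ 0#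
  ... | yes _ = x
  ... | no  _ = 1#

  *-unzero : ∀ {x} → x ≢ 0# → ∀ y → x * unzero y ≡ unzero (x * y) * correction x y
  *-unzero {x} x≢0 y with y ≟ 0# | (x * y) ≟ 0#
  ... | yes _   | yes _    = R.*-comm x 1#
  ... | yes y≡0 | no xy≢0  = contradiction (≡-trans (cong (x *_) y≡0) (R.zeroʳ x)) xy≢0
  ... | no  y≢0 | yes xy≡0 = ⊥-elim ([ x≢0 , y≢0 ] (x*y≡0⇒x≡0⊎y≡0 xy≡0))
  ... | no  _   | no  _    = ≡-sym (R.*-identityʳ (x * y))

  ∏-correction : ∀ x → ∏.sum (correction x ∘ elem) ≡ x
  ∏-correction x = begin
    ∏.sum (correction x ∘ elem)  ≡⟨ ∏-single (correction x ∘ elem) (Inverse.from enum 0#) correction≡1 ⟩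
    correction x (elem _)        ≡⟨ cong (correction x) (Inverse.strictlyInverseˡ enum 0#) ⟩
    correction x 0#              ≡⟨ correction-0 ⟩
    x                            ∎
    where
    correction-0 : correction x 0# ≡ x
    correction-0 with 0# ≟ 0#
    ... | yes _   = refl
    ... | no  0≢0 = contradiction refl 0≢0
    correction≡1 : ∀ j → j ≢ Inverse.from enum 0# → correction x (elem j) ≡ 1#
    correction≡1 j j≢0 with elem j ≟ 0#
    ... | yes elemⱼ≡0 = contradiction
      (≡-trans (≡-sym (Inverse.strictlyInverseʳ enum j)) (cong (Inverse.from enum) elemⱼ≡0)) j≢0
    ... | no  _    = refl

  0↑size≡0 : 0# ↑ size ≡ 0#
  0↑size≡0 with size | Inverse.from enum 0#
  ... | suc _ | _ = R.zeroˡ _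

  fermat : ∀ x → x ↑ size ≡ x
  fermat x with x ≟ 0#
  ... | yes refl = 0↑size≡0
  ... | no  x≢0  = *-cancelˡ (∏-≢0 (unzero ∘ elem) (unzero≢0 ∘ elem)) (begin
    U * x ↑ size
      ≡⟨ R.*-comm U (x ↑ size) ⟩
    x ↑ size * U
      ≡⟨ cong (_* U) (≡-trans (↑≡^ x size) (≡-sym (∏.sum-replicate size))) ⟩
    ∏.sum {size} (λ _ → x) * U
      ≡⟨ ∏.∑-distrib-+ (λ _ → x) (unzero ∘ elem) ⟨
    ∏.sum (λ i → x * unzero (elem i))
      ≡⟨ ∏.sum-cong-≗ (*-unzero x≢0 ∘ elem) ⟩
    ∏.sum (λ i → unzero (x * elem i) * correction x (elem i))
      ≡⟨ ∏.∑-distrib-+ (unzero ∘ (x *_) ∘ elem) (correction x ∘ elem) ⟩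
    ∏.sum (unzero ∘ (x *_) ∘ elem) * ∏.sum (correction x ∘ elem)
      ≡⟨ cong₂ _*_ (sum-reindex R.*-commutativeMonoid (scaling↔ x≢0) unzero) (∏-correction x) ⟩
    U * x
      ∎)
    where U = ∏.sum (unzero ∘ elem)

  ^·1≡·1↑ : ∀ p m → (p ℕ.^ m) · 1# ≡ (p · 1#) ↑ m
  ^·1≡·1↑ p zero    = R.+-identityʳ 1#
  ^·1≡·1↑ p (suc m) = ≡-trans (×1-homo-* p (p ℕ.^ m)) (cong ((p · 1#) *_) (^·1≡·1↑ p m))

  p^m·1≡0⇒p·1≡0 : ∀ {p} m → (p ℕ.^ m) · 1# ≡ 0# → p · 1# ≡ 0#
  p^m·1≡0⇒p·1≡0 {p} m pᵐ·1≡0 = x^n≡0⇒x≡0 m (≡-trans (≡-sym (^·1≡·1↑ p m)) pᵐ·1≡0)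

  1+1≡0⇒even : 1# + 1# ≡ 0# → ∀ n → n · 1# ≡ 0# → 2 ∣ n
  1+1≡0⇒even _   zero          _          = 2 ∣0
  1+1≡0⇒even _   (suc zero)    1+0≡0      = contradiction (≡-trans (≡-sym (R.+-identityʳ 1#)) 1+0≡0) 1≢0
  1+1≡0⇒even 2≡0 (suc (suc n)) [2+n]·1≡0 = ∣m∣n⇒∣m+n ∣-refl (1+1≡0⇒even 2≡0 n (begin
    n · 1#                  ≡⟨ R.+-identityˡ (n · 1#) ⟨
    0# + n · 1#             ≡⟨ cong (_+ n · 1#) 2≡0 ⟨
    (1# + 1#) + n · 1#      ≡⟨ R.+-assoc 1# 1# (n · 1#) ⟩
    1# + (1# + n · 1#)      ≡⟨ [2+n]·1≡0 ⟩
    0#                      ∎))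

  1+1≢0 : ∀ {p} → Prime p → p ≢ 2 → p · 1# ≡ 0# → 1# + 1# ≢ 0#
  1+1≢0 {p} p-prime p≢2 p·1≡0 2≡0 with prime⇒irreducible p-prime (1+1≡0⇒even 2≡0 p p·1≡0)
  ... | inj₁ ()
  ... | inj₂ 2≡p = p≢2 (≡-sym 2≡p)

  p∣n⇒n·≡0 : ∀ {p n} → p · 1# ≡ 0# → p ∣ n → ∀ z → n · z ≡ 0#
  p∣n⇒n·≡0 {p} p·1≡0 (divides m refl) z = begin
    (m ℕ.* p) · z         ≡⟨ cong (_· z) (ℕ.*-comm m p) ⟩
    (p ℕ.* m) · z         ≡⟨ ×-assocˡ z p m ⟨
    p · (m · z)           ≡⟨ cong (p ·_) (R.*-identityˡ (m · z)) ⟨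
    p · (1# * (m · z))    ≡⟨ ×-assoc-* p 1# (m · z) ⟨
    (p · 1#) * (m · z)    ≡⟨ cong (_* (m · z)) p·1≡0 ⟩
    0# * (m · z)          ≡⟨ R.zeroˡ (m · z) ⟩
    0#                    ∎

  frobenius : ∀ {p} → Prime p → p · 1# ≡ 0# → ∀ x y → (x + y) ↑ p ≡ x ↑ p + y ↑ p
  frobenius {p@(suc p′)} p-prime p·1≡0 x y = begin
    (x + y) ↑ p                                      ≡⟨ ↑≡^ (x + y) p ⟩
    (x + y) Exp.^ p                                  ≡⟨ Binomial.theorem p x y ⟩
    t zero + ∑.sum (t ∘ suc)                         ≡⟨ cong (t zero +_) (∑.sum-init-last (t ∘ suc)) ⟩
    t zero + (∑.sum (init (t ∘ suc)) + t (fromℕ p))  ≡⟨ cong (λ s → t zero + (s + t (fromℕ p))) ∑-middle≡0 ⟩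
    t zero + (0# + t (fromℕ p))                      ≡⟨ cong₂ (λ u v → u + (0# + v)) t₀≡yᵖ tₚ≡xᵖ ⟩
    y ↑ p + (0# + x ↑ p)                             ≡⟨ cong (y ↑ p +_) (R.+-identityˡ (x ↑ p)) ⟩
    y ↑ p + x ↑ p                                    ≡⟨ R.+-comm (y ↑ p) (x ↑ p) ⟩
    x ↑ p + y ↑ p                                    ∎
    where
    t : Fin (suc p) → Carrier
    t = Binomial.binomialTerm x y p
    t₀≡yᵖ : t zero ≡ y ↑ p
    t₀≡yᵖ = ≡-trans (R.+-identityʳ (1# * y Exp.^ p)) (≡-trans (R.*-identityˡ _) (≡-sym (↑≡^ y p)))
    tₚ≡xᵖ : t (fromℕ p) ≡ x ↑ p
    tₚ≡xᵖ = begin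
      t (fromℕ p)
        ≡⟨ cong (λ k → (p C k) · (x Exp.^ k * y Exp.^ (p ∸ k))) (toℕ-fromℕ p) ⟩
      (p C p) · (x Exp.^ p * y Exp.^ (p ∸ p))
        ≡⟨ cong₂ (λ c d → c · (x Exp.^ p * y Exp.^ d)) (nCn≡1 p) (ℕ.n∸n≡0 p) ⟩
      x Exp.^ p * 1# + 0#
        ≡⟨ ≡-trans (R.+-identityʳ _) (R.*-identityʳ _) ⟩
      x Exp.^ p
        ≡⟨ ↑≡^ x p ⟨
      x ↑ p
        ∎
    ∑-middle≡0 : ∑.sum (init (t ∘ suc)) ≡ 0#
    ∑-middle≡0 = ≡-trans (∑.sum-cong-≗ λ i → p∣n⇒n·≡0 p·1≡0 (p∣C i) _) (∑.sum-replicate-zero p′)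
      where
      p∣C : ∀ i → p ∣ p C suc (toℕ (inject₁ i))
      p∣C i = prime∣choose p-prime (ℕ.s≤s ℕ.z≤n)
                (ℕ.s≤s (subst (_< p′) (≡-sym (toℕ-inject₁ i)) (toℕ<n i)))

  frobenius^ : ∀ {p} → Prime p → p · 1# ≡ 0# →
               ∀ k x y → (x + y) ↑ (p ℕ.^ k) ≡ x ↑ (p ℕ.^ k) + y ↑ (p ℕ.^ k)
  frobenius^ _ _ zero x y = R.distribʳ 1# x y
  frobenius^ {p} p-prime p·1≡0 (suc k) x y = begin
    (x + y) ↑ (p ℕ.* q)           ≡⟨ ↑-assoc (x + y) p q ⟨
    ((x + y) ↑ p) ↑ q             ≡⟨ cong (_↑ q) (frobenius p-prime p·1≡0 x y) ⟩
    (x ↑ p + y ↑ p) ↑ q           ≡⟨ frobenius^ p-prime p·1≡0 k (x ↑ p) (y ↑ p) ⟩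
    (x ↑ p) ↑ q + (y ↑ p) ↑ q     ≡⟨ cong₂ _+_ (↑-assoc x p q) (↑-assoc y p q) ⟩
    x ↑ (p ℕ.* q) + y ↑ (p ℕ.* q) ∎
    where q = p ℕ.^ k

  module Involution (σ : Carrier → Carrier)
    (σ-+ : ∀ x y → σ (x + y) ≡ σ x + σ y)
    (σ-* : ∀ x y → σ (x * y) ≡ σ x * σ y)
    (σ-involutive : ∀ x → σ (σ x) ≡ x) where

    Fixed AntiFixed : Set
    Fixed     = Σ Carrier λ x → σ x ≡ x
    AntiFixed = Σ Carrier λ x → σ x ≡ - x

    σ-0 : σ 0# ≡ 0#
    σ-0 = x+x≈x⇒x≈0 (σ 0#) (≡-trans (≡-sym (σ-+ 0# 0#)) (cong σ (R.+-identityʳ 0#)))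

    σ-‿ : ∀ x → σ (- x) ≡ - σ x
    σ-‿ x = inverseʳ-unique (σ x) (σ (- x))
              (≡-trans (≡-sym (σ-+ x (- x))) (≡-trans (cong σ (R.-‿inverseʳ x)) σ-0))

    σ[a+b]≡a-b : ∀ {a b} → σ a ≡ a → σ b ≡ - b → σ (a + b) ≡ a + - b
    σ[a+b]≡a-b {a} {b} σa≡a σb≡-b = ≡-trans (σ-+ a b) (cong₂ _+_ σa≡a σb≡-b)

    trace : Carrier → Carrier
    trace x = x + σ x

    σ-trace : ∀ x → σ (trace x) ≡ σ x + x
    σ-trace x = ≡-trans (σ-+ x (σ x)) (cong (σ x +_) (σ-involutive x))

    σ[x-σx] : ∀ x → σ (x + - σ x) ≡ σ x + - x
    σ[x-σx] x = ≡-trans (σ-+ x (- σ x)) (cong (σ x +_) (≡-trans (σ-‿ (σ x)) (cong -_ (σ-involutive x))))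

    trace≡0⇔anti-fixed : ∀ {x} → trace x ≡ 0# ⇔ σ x ≡ - x
    trace≡0⇔anti-fixed {x} = mk⇔ (inverseʳ-unique x (σ x))
      (λ σx≡-x → ≡-trans (cong (x +_) σx≡-x) (R.-‿inverseʳ x))

    module Splitting (½ : Carrier) (½+½≡1 : ½ + ½ ≡ 1#) where

      halves : ∀ x → ½ * x + ½ * x ≡ x
      halves x = ≡-trans (≡-sym (R.distribʳ x ½ ½)) (≡-trans (cong (_* x) ½+½≡1) (R.*-identityˡ x))

      σ-½* : ∀ x → σ (½ * x) ≡ ½ * σ x
      σ-½* x = begin
        σ (½ * x)                         ≡⟨ halves (σ (½ * x)) ⟨
        ½ * σ (½ * x) + ½ * σ (½ * x)     ≡⟨ R.distribˡ ½ _ _ ⟨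
        ½ * (σ (½ * x) + σ (½ * x))       ≡⟨ cong (½ *_) (σ-+ (½ * x) (½ * x)) ⟨
        ½ * σ (½ * x + ½ * x)             ≡⟨ cong (λ y → ½ * σ y) (halves x) ⟩
        ½ * σ x                           ∎

      ↔Fixed×AntiFixed : Carrier ↔ (Fixed × AntiFixed)
      ↔Fixed×AntiFixed = mk↔ₛ′ to from to∘from from∘to
        where
        to : Carrier → Fixed × AntiFixed
        to x = (½ * (x + σ x) , fixed) , (½ * (x + - σ x) , anti-fixed)
          where
          fixed = begin
            σ (½ * (x + σ x))          ≡⟨ σ-½* (x + σ x) ⟩
            ½ * σ (x + σ x)            ≡⟨ cong (½ *_) (σ-trace x) ⟩
            ½ * (σ x + x)              ≡⟨ cong (½ *_) (R.+-comm (σ x) x) ⟩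
            ½ * (x + σ x)              ∎
          anti-fixed = begin
            σ (½ * (x + - σ x))        ≡⟨ σ-½* (x + - σ x) ⟩
            ½ * σ (x + - σ x)          ≡⟨ cong (½ *_) (σ[x-σx] x) ⟩
            ½ * (σ x + - x)
              ≡⟨ solve 3 (λ h x y → h :* (y :+ :- x) := :- (h :* (x :+ :- y))) refl ½ x (σ x) ⟩
            - (½ * (x + - σ x))        ∎
        from : Fixed × AntiFixed → Carrier
        from ((a , _) , (b , _)) = a + b
        from∘to : ∀ x → from (to x) ≡ x
        from∘to x = ≡-trans
          (solve 3 (λ h x y → h :* (x :+ y) :+ h :* (x :+ :- y) := h :* x :+ h :* x) refl ½ x (σ x))
          (halves x)
        to∘from : ∀ u → to (from u) ≡ u
        to∘from ((a , σa≡a) , (b , σb≡-b)) = cong₂ _,_ (subtype-≡ (begin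
            ½ * ((a + b) + σ (a + b))      ≡⟨ cong (λ y → ½ * ((a + b) + y)) (σ[a+b]≡a-b σa≡a σb≡-b) ⟩
            ½ * ((a + b) + (a + - b))
              ≡⟨ solve 3 (λ h a b → h :* ((a :+ b) :+ (a :+ :- b)) := h :* a :+ h :* a) refl ½ a b ⟩
            ½ * a + ½ * a                  ≡⟨ halves a ⟩
            a                              ∎))
          (subtype-≡ (begin
            ½ * ((a + b) + - σ (a + b))    ≡⟨ cong (λ y → ½ * ((a + b) + - y)) (σ[a+b]≡a-b σa≡a σb≡-b) ⟩
            ½ * ((a + b) + - (a + - b))
              ≡⟨ solve 3 (λ h a b → h :* ((a :+ b) :+ :- (a :+ :- b)) := h :* b :+ h :* b) refl ½ a b ⟩
            ½ * b + ½ * b                  ≡⟨ halves b ⟩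
            b                              ∎))

    module _ {c} (σc≡c : σ c ≡ c) (c≢0 : c ≢ 0#) where

      cxTr : Carrier → Carrier
      cxTr x = c * (x * trace x)

      cxTr≡0⇔anti-fixed : ∀ {x} → cxTr x ≡ 0# ⇔ σ x ≡ - x
      cxTr≡0⇔anti-fixed {x} = mk⇔ (Equivalence.to trace≡0⇔anti-fixed ∘ trace≡0) λ σx≡-x → begin
        c * (x * trace x)   ≡⟨ cong (λ t → c * (x * t)) (Equivalence.from trace≡0⇔anti-fixed σx≡-x) ⟩
        c * (x * 0#)        ≡⟨ ≡-trans (cong (c *_) (R.zeroʳ x)) (R.zeroʳ c) ⟩
        0#                  ∎
        where
        trace≡0 : cxTr x ≡ 0# → trace x ≡ 0#
        trace≡0 cxTr≡0 with x*y≡0⇒x≡0⊎y≡0 cxTr≡0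
        ... | inj₁ c≡0 = contradiction c≡0 c≢0
        ... | inj₂ x·Tr≡0 with x*y≡0⇒x≡0⊎y≡0 x·Tr≡0
        ...   | inj₁ refl = ≡-trans (R.+-identityˡ (σ 0#)) σ-0
        ...   | inj₂ Tr≡0 = Tr≡0

      cxTr+σcxTr : ∀ x → cxTr x + σ (cxTr x) ≡ c * (trace x * trace x)
      cxTr+σcxTr x = begin
        c * (x * (x + σ x)) + σ (c * (x * (x + σ x)))
          ≡⟨ cong (cxTr x +_) σ[cxTr] ⟩
        c * (x * (x + σ x)) + c * (σ x * (σ x + x))
          ≡⟨ solve 3 (λ c x y → c :* (x :* (x :+ y)) :+ c :* (y :* (y :+ x)) := c :* ((x :+ y) :* (x :+ y)))
                   refl c x (σ x) ⟩
        c * ((x + σ x) * (x + σ x))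
          ∎
        where
        σ[cxTr] : σ (cxTr x) ≡ c * (σ x * (σ x + x))
        σ[cxTr] = ≡-trans (σ-* c _) (cong₂ _*_ σc≡c (≡-trans (σ-* x _) (cong (σ x *_) (σ-trace x))))

      cxTr-anti-fixed⇒≡0 : ∀ x → σ (cxTr x) ≡ - cxTr x → cxTr x ≡ 0#
      cxTr-anti-fixed⇒≡0 x σy≡-y = Equivalence.from cxTr≡0⇔anti-fixed
        (Equivalence.to trace≡0⇔anti-fixed ([ id , id ] (x*y≡0⇒x≡0⊎y≡0 Tr²≡0)))
        where
        Tr²≡0 : trace x * trace x ≡ 0#
        Tr²≡0 = *-cancelˡ c≢0 (begin
          c * (trace x * trace x)      ≡⟨ cxTr+σcxTr x ⟨
          cxTr x + σ (cxTr x)          ≡⟨ cong (cxTr x +_) σy≡-y ⟩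
          cxTr x + - cxTr x            ≡⟨ R.-‿inverseʳ (cxTr x) ⟩
          0#                           ≡⟨ R.zeroʳ c ⟨
          c * 0#                       ∎)

    anti-fixed*fixed : ∀ {β x} → σ β ≡ - β → σ x ≡ x → σ (β * x) ≡ - (β * x)
    anti-fixed*fixed {β} {x} σβ≡-β σx≡x =
      ≡-trans (σ-* β x) (≡-trans (cong₂ _*_ σβ≡-β σx≡x) (≡-sym (-‿distribˡ-* β x)))

    Fixed↔AntiFixed : ∀ {β} → σ β ≡ - β → β ≢ 0# → Fixed ↔ AntiFixed
    Fixed↔AntiFixed {β} σβ≡-β β≢0 with inverse β β≢0
    ... | β⁻¹ , ββ⁻¹≡1 = mk↔ₛ′ to from
      (λ _ → subtype-≡ (β[β⁻¹y]≡y _)) (λ _ → subtype-≡ (x*y≡1⇒x*[y*z]≡z (x*y≡1⇒y*x≡1 ββ⁻¹≡1) _))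
      where
      β[β⁻¹y]≡y : ∀ y → β * (β⁻¹ * y) ≡ y
      β[β⁻¹y]≡y = x*y≡1⇒x*[y*z]≡z ββ⁻¹≡1
      to : Fixed → AntiFixed
      to (x , σx≡x) = β * x , anti-fixed*fixed σβ≡-β σx≡x
      from : AntiFixed → Fixed
      from (y , σy≡-y) = β⁻¹ * y , *-cancelˡ -β≢0 (begin
        - β * σ (β⁻¹ * y)     ≡⟨ ≡-trans (σ-* β (β⁻¹ * y)) (cong (_* σ (β⁻¹ * y)) σβ≡-β) ⟨
        σ (β * (β⁻¹ * y))     ≡⟨ cong σ (β[β⁻¹y]≡y y) ⟩
        σ y                   ≡⟨ σy≡-y ⟩
        - y                   ≡⟨ cong -_ (β[β⁻¹y]≡y y) ⟨
        - (β * (β⁻¹ * y))     ≡⟨ -‿distribˡ-* β (β⁻¹ * y) ⟩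
        - β * (β⁻¹ * y)       ∎)
        where
        -β≢0 : - β ≢ 0#
        -β≢0 -β≡0 = β≢0 (≡-trans (≡-sym (-‿involutive β)) (≡-trans (cong -_ -β≡0) -0#≈0#))

  module QuadraticExtension {p} (p-prime : Prime p) (p≢2 : p ≢ 2) (k : ℕ)
    (size≡q² : size ≡ p ^ k ℕ.* p ^ k) where

    q : ℕ
    q = p ^ k

    p·1≡0 : p · 1# ≡ 0#
    p·1≡0 = p^m·1≡0⇒p·1≡0 (k ℕ.+ k) (begin
      (p ^ (k ℕ.+ k)) · 1#  ≡⟨ cong (_· 1#) (ℕ.^-distribˡ-+-* p k k) ⟩
      (q ℕ.* q) · 1#        ≡⟨ cong (_· 1#) size≡q² ⟨
      size · 1#             ≡⟨ size·1≡0 ⟩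
      0#                    ∎)

    σ : Carrier → Carrier
    σ x = x ↑ q

    σ-involutive : ∀ x → σ (σ x) ≡ x
    σ-involutive x = ≡-trans (↑-assoc x q q) (≡-trans (cong (x ↑_) (≡-sym size≡q²)) (fermat x))

    open Involution σ (frobenius^ p-prime p·1≡0 k) (λ x y → ↑-distrib-* x y q) σ-involutive public

    ↔AntiFixed² : ∀ {β} → σ β ≡ - β → β ≢ 0# → Carrier ↔ (AntiFixed × AntiFixed)
    ↔AntiFixed² σβ≡-β β≢0 with inverse (1# + 1#) (1+1≢0 p-prime p≢2 p·1≡0)
    ... | ½ , 2·½≡1 = (Fixed↔AntiFixed σβ≡-β β≢0 ×-↔ ↔-id _) ↔-∘ Splitting.↔Fixed×AntiFixed ½ ½+½≡1
      where
      ½+½≡1 : ½ + ½ ≡ 1#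
      ½+½≡1 = begin
        ½ + ½                ≡⟨ cong₂ _+_ (R.*-identityˡ ½) (R.*-identityˡ ½) ⟨
        1# * ½ + 1# * ½      ≡⟨ R.distribʳ ½ 1# 1# ⟨
        (1# + 1#) * ½        ≡⟨ 2·½≡1 ⟩
        1#                   ∎

    AntiFixed-count : ∀ {β m} → σ β ≡ - β → β ≢ 0# → Fin m ↔ AntiFixed → m ≡ q
    AntiFixed-count {m = m} σβ≡-β β≢0 m↔A = m*m≡n*n⇒m≡n (≡-trans (↔⇒≡ π) size≡q²)
      where
      π : Fin (m ℕ.* m) ↔ Fin size
      π = ↔-sym enum ↔-∘ (↔-sym (↔AntiFixed² σβ≡-β β≢0) ↔-∘ ((m↔A ×-↔ m↔A) ↔-∘ *↔×))

    module _ {b} (σb≡b : σ b ≡ b) (b-nonsquare : ¬ ∃ λ y → σ y ≡ y × y * y ≡ b)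
             {β} (β*β≡b : β * β ≡ b) where

      nonsquare-root-anti-fixed : σ β ≡ - β
      nonsquare-root-anti-fixed with x*x≡y*y⇒x≡y⊎x≡-y σβ*σβ≡β*β
        where
        σβ*σβ≡β*β : σ β * σ β ≡ β * β
        σβ*σβ≡β*β = begin
          σ β * σ β    ≡⟨ ↑-distrib-* β β q ⟨
          σ (β * β)    ≡⟨ cong σ β*β≡b ⟩
          σ b          ≡⟨ σb≡b ⟩
          b            ≡⟨ β*β≡b ⟨
          β * β        ∎
      ... | inj₁ σβ≡β  = contradiction (β , σβ≡β , β*β≡b) b-nonsquare
      ... | inj₂ σβ≡-β = σβ≡-β

      nonsquare-root≢0 : β ≢ 0#
      nonsquare-root≢0 refl = b-nonsquare (0# , σ-0 , β*β≡b)

    module _ {c} (σc≡c : σ c ≡ c) (c≢0 : c ≢ 0#) where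

      f : Carrier → Carrier
      f x = c * (x ↑ (q ℕ.+ 1) + x ↑ 2)

      f≗cxTr : ∀ x → f x ≡ cxTr σc≡c c≢0 x
      f≗cxTr x = cong (c *_) (begin
        x ↑ (q ℕ.+ 1) + x ↑ 2      ≡⟨ cong₂ (λ n y → x ↑ n + x * y) (ℕ.+-comm q 1) (R.*-identityʳ x) ⟩
        x * σ x + x * x            ≡⟨ solve 2 (λ x y → x :* y :+ x :* x := x :* (x :+ y)) refl x (σ x) ⟩
        x * trace x                ∎)

      zeros↔AntiFixed : (Σ Carrier λ x → f x ≡ 0#) ↔ AntiFixed
      zeros↔AntiFixed = subtype-↔
        (λ {x} fx≡0 → Equivalence.to (cxTr≡0⇔anti-fixed σc≡c c≢0) (≡-trans (≡-sym (f≗cxTr x)) fx≡0))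
        (λ {x} σx≡-x → ≡-trans (f≗cxTr x) (Equivalence.from (cxTr≡0⇔anti-fixed σc≡c c≢0) σx≡-x))

      preimageCount-zero : ∀ {β} → σ β ≡ - β → β ≢ 0# → preimageCount f 0# ≡ q
      preimageCount-zero σβ≡-β β≢0 =
        AntiFixed-count σβ≡-β β≢0 (zeros↔AntiFixed ↔-∘ preimageCount↔ f 0#)

      preimageCount-anti-fixed : ∀ {α} → σ α ≡ - α → α ≢ 0# → preimageCount f α ≡ 0
      preimageCount-anti-fixed {α} σα≡-α α≢0 = Fin↔⊥⇒≡0 (preimageCount↔ f α) λ (x , fx≡α) →
        let cxTr≡α = ≡-trans (≡-sym (f≗cxTr x)) fx≡α in
        α≢0 (≡-trans (≡-sym cxTr≡α) (cxTr-anti-fixed⇒≡0 σc≡c c≢0 x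
          (subst (λ y → σ y ≡ - y) (≡-sym cxTr≡α) σα≡-α)))

theorem3p1 : (L : FiniteField) → let open FF L in
    (p k : ℕ) → Prime p → p ≢ 2 → k ≥ 1 →
    let q = p ^ k in
    size ≡ q Data.Nat.* q →
    (c : Carrier) → c ↑ q ≡ c → c ≢ 0# →
    (b β : Carrier) → b ↑ q ≡ b →
    ¬ (∃ λ y → y ↑ q ≡ y × y * y ≡ b) →
    β * β ≡ b →
    (α : Carrier) → (∃ λ t → t ↑ q ≡ t × α ≡ β * t) →
    let f = λ (x : Carrier) → c * (x ↑ (q Data.Nat.+ 1) + x ↑ 2) in
    (α ≡ 0# → preimageCount f α ≡ q) × (α ≢ 0# → preimageCount f α ≡ 0)
theorem3p1 L p k p-prime p≢2 _ size≡q² c σc≡c c≢0 b β σb≡b b-nonsquare β*β≡b α (t , σt≡t , α≡βt) =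
    (λ { refl → preimageCount-zero σc≡c c≢0 σβ≡-β (nonsquare-root≢0 σb≡b b-nonsquare β*β≡b) })
  , preimageCount-anti-fixed σc≡c c≢0 σα≡-α
  where
  open FF L
  open FiniteFieldTheory L
  open QuadraticExtension p-prime p≢2 k size≡q²
  σβ≡-β : σ β ≡ - β
  σβ≡-β = nonsquare-root-anti-fixed σb≡b b-nonsquare β*β≡b
  σα≡-α : σ α ≡ - α
  σα≡-α = subst (λ a → σ a ≡ - a) (≡-sym α≡βt) (anti-fixed*fixed σβ≡-β σt≡t)
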